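{- For all integers $n>1$ and $s>0$, the partition $(n,1^s)$ is a $\mathcal P$-position of LCTR; hence $\mathrm{SG}(n,1^s)=0$.
   Context: $(n,1^s)$ is the partition with one part $n$ followed by $s$ parts equal to $1$. LCTR: from nonempty $\lambda=(\lambda_1,\dots,\lambda_k)$ one may move to $T(\lambda)=(\lambda_2,\dots,\lambda_k)$ or $L(\lambda)=(\lambda_1-1,\dots,\lambda_k-1)$ (nonpositive entries omitted); $()$ has no moves; normal play. A $\mathcal P$-position is one from which the previous player has a winning strategy. $\mathrm{SG}(())=0$, $\mathrm{SG}(\lambda)=\mathrm{mex}\{\mathrm{SG}(L(\lambda)),\mathrm{SG}(T(\lambda))\}$ otherwise. -}

module Defs where

open import Data.Nat using (ℕ; zero; suc; _+_; _≟_; pred)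
open import Data.List using (List; []; _∷_; map; length; replicate)
open import Data.Nat.ListAction using (sum)
open import Data.Product using (_×_; _,_)
open import Relation.Nullary using (yes; no)
open import Data.List.Membership.DecPropositional _≟_ using (_∈?_)

-- A partition is a (weakly decreasing) list of positive naturals.
Partition : Set
Partition = List ℕ

dropZeros : List ℕ → List ℕ
dropZeros [] = []
dropZeros (zero ∷ xs) = dropZeros xs
dropZeros (suc x ∷ xs) = suc x ∷ dropZeros xs

T : Partition → Partition
T [] = []
T (_ ∷ xs) = xs

L : Partition → Partition
L xs = dropZeros (map pred xs)

data Move : Partition → Partition → Set where
  moveT : ∀ x xs → Move (x ∷ xs) (T (x ∷ xs))
  moveL : ∀ x xs → Move (x ∷ xs) (L (x ∷ xs))

-- Normal play outcome classes (inductively: finite games).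
data IsP : Partition → Set
data IsN : Partition → Set

data IsP where
  isP : ∀ {λ′} → (∀ μ → Move λ′ μ → IsN μ) → IsP λ′

data IsN where
  isN : ∀ {λ′} μ → Move λ′ μ → IsP μ → IsN λ′

mexAux : List ℕ → ℕ → ℕ → ℕ
mexAux xs k zero = k
mexAux xs k (suc f) with k ∈? xs
... | yes _ = mexAux xs (suc k) f
... | no _ = k

mex : List ℕ → ℕ
mex xs = mexAux xs 0 (length xs)

-- Sprague–Grundy value, by recursion on fuel (sum + length strictly decreases along moves)
sgFuel : ℕ → Partition → ℕ
sgFuel zero _ = 0
sgFuel (suc f) [] = 0
sgFuel (suc f) (x ∷ xs) = mex (sgFuel f (L (x ∷ xs)) ∷ sgFuel f (T (x ∷ xs)) ∷ [])

SG : Partition → ℕ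
SG λ′ = sgFuel (suc (sum λ′ + length λ′)) λ′

hook : ℕ → ℕ → Partition
hook n s = n ∷ replicate s 1

-- Both options of (n, 1^s) can move to the empty partition, so both are
-- N-positions with nonzero Grundy value: T gives 1^s, whose L-move empties it,
-- and L gives the single part n − 1, whose T-move empties it.
module Submission where

open import Defs
open import Data.Nat using (ℕ; zero; suc; _+_; _>_; s≤s; NonZero)
open import Data.Nat.ListAction using (sum)
open import Data.Product using (_×_; _,_)
open import Data.List using ([]; _∷_; replicate; length)
open import Relation.Binary.PropositionalEquality using (_≡_; refl; sym; cong; subst)

[]-isP : IsP []
[]-isP = isP λ _ ()

isN-of-move-to-[] : ∀ {λ′} → Move λ′ [] → IsN λ′
isN-of-move-to-[] m = isN [] m []-isP

L-replicate-1 : ∀ t → L (replicate t 1) ≡ []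
L-replicate-1 zero    = refl
L-replicate-1 (suc t) = L-replicate-1 t

L-hook : ∀ k s → L (hook (suc (suc k)) s) ≡ suc k ∷ []
L-hook k s = cong (suc k ∷_) (L-replicate-1 s)

sgFuel-[] : ∀ g → sgFuel g [] ≡ 0
sgFuel-[] zero    = refl
sgFuel-[] (suc g) = refl

mex-0∷-nonZero : ∀ y → NonZero (mex (0 ∷ y ∷ []))
mex-0∷-nonZero zero          = _
mex-0∷-nonZero (suc zero)    = _
mex-0∷-nonZero (suc (suc y)) = _

mex-∷0-nonZero : ∀ y → NonZero (mex (y ∷ 0 ∷ []))
mex-∷0-nonZero zero          = _
mex-∷0-nonZero (suc zero)    = _
mex-∷0-nonZero (suc (suc y)) = _

mex-nonZero-pair : ∀ a b → NonZero a → NonZero b → mex (a ∷ b ∷ []) ≡ 0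
mex-nonZero-pair (suc a) (suc b) _ _ = refl

sgFuel-nonZero-of-L-[] : ∀ g x xs → L (x ∷ xs) ≡ [] → NonZero (sgFuel (suc g) (x ∷ xs))
sgFuel-nonZero-of-L-[] g x xs L≡[] =
  subst (λ μ → NonZero (mex (sgFuel g μ ∷ sgFuel g xs ∷ [])))
        (sym L≡[])
        (subst (λ v → NonZero (mex (v ∷ sgFuel g xs ∷ []))) (sym (sgFuel-[] g))
               (mex-0∷-nonZero (sgFuel g xs)))

sgFuel-nonZero-of-T-[] : ∀ g x → NonZero (sgFuel (suc g) (x ∷ []))
sgFuel-nonZero-of-T-[] g x =
  subst (λ v → NonZero (mex (sgFuel g (L (x ∷ [])) ∷ v ∷ []))) (sym (sgFuel-[] g))
        (mex-∷0-nonZero (sgFuel g (L (x ∷ []))))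

hook-isP : ∀ k t → IsP (hook (suc (suc k)) (suc t))
hook-isP k t = isP options-isN
  where
  options-isN : ∀ μ → Move (hook (suc (suc k)) (suc t)) μ → IsN μ
  options-isN _ (moveT _ _) =
    isN-of-move-to-[] (subst (Move _) (L-replicate-1 (suc t)) (moveL 1 (replicate t 1)))
  options-isN _ (moveL _ _) =
    subst IsN (sym (L-hook k (suc t))) (isN-of-move-to-[] (moveT (suc k) []))

hook-sgFuel : ∀ g k t → sgFuel (suc (suc g)) (hook (suc (suc k)) (suc t)) ≡ 0
hook-sgFuel g k t =
  mex-nonZero-pair _ _
    (subst (λ μ → NonZero (sgFuel (suc g) μ)) (sym (L-hook k (suc t)))
           (sgFuel-nonZero-of-T-[] g (suc k)))
    (sgFuel-nonZero-of-L-[] g 1 (replicate t 1) (L-replicate-1 (suc t)))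

-- The fuel of SG at this hook, written out so that hook-sgFuel applies.
hook-SG : ∀ k t → SG (hook (suc (suc k)) (suc t)) ≡ 0
hook-SG k t = hook-sgFuel (suc (k + sum (replicate (suc t) 1) + length (hook (suc (suc k)) (suc t)))) k t

lemma3p11 : (n s : ℕ) → n > 1 → s > 0 → IsP (hook n s) × SG (hook n s) ≡ 0
lemma3p11 (suc (suc k)) (suc t) (s≤s (s≤s _)) (s≤s _) = hook-isP k t , hook-SG k t
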